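{- Let $n$ be odd, $s_1,\dots,s_n$ pairwise distinct positive integers, $\mathbf{s}=(s_1,\dots,s_n)$, $\mathbf{s}^j:=(s_i)_{i\ne j}$, and assume all multiple zeta values appearing below converge. Then $$\sum_{\sigma\in S_n}\operatorname{sgn}(\sigma)\zeta_{\mathbb{Q}}(\sigma(\mathbf{s}))=\sum_{j=1}^n(-1)^{n-j}\zeta_{\mathbb{Q}}(s_j)\sum_{\sigma\in S_n^j}\operatorname{sgn}(\sigma)\zeta_{\mathbb{Q}}(\sigma(\mathbf{s}^j)).$$
   Context: $\zeta_{\mathbb{Q}}(s_1,\dots,s_r):=\sum_{m_1>\cdots>m_r\ge1}m_1^{ -s_1}\cdots m_r^{ -s_r}$ is the classical multiple zeta value. $S_n$ is the symmetric group on $\{1,\dots,n\}$, $\sigma(\mathbf{s})=(s_{\sigma(1)},\dots,s_{\sigma(n)})$; $S_n^j$ is the symmetric group of $\{1,\dots,n\}\setminus\{j\}$ (sign as a permutation of that set), and $\sigma(\mathbf{s}^j)=(s_{\sigma(1)},\dots,s_{\sigma(j-1)},s_{\sigma(j+1)},\dots,s_{\sigma(n)})$. -}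

module Defs where

open import Data.Nat as ℕ using (ℕ; zero; suc)
open import Data.Integer as ℤ using (ℤ; +_)
open import Data.Rational as ℚ using (ℚ; 0ℚ; 1ℚ; _+_; _*_; _-_; -_; ∣_∣; _<_; _/_)
open import Data.List using (allFin; List; []; _∷_; length; map; concat; removeAt; lookup)
open import Data.List.Relation.Unary.All using (All)
open import Data.Fin as Fin using (Fin; toℕ)
open import Data.Product using (_×_; _,_; Σ; ∃; proj₁; proj₂)

sgnPow : ℕ → ℚ
sgnPow zero = 1ℚ
sgnPow (suc k) = - sgnPow k

powℚ : ℚ → ℕ → ℚ
powℚ q zero = 1ℚ
powℚ q (suc k) = q * powℚ q k

sumTo : ℕ → (ℕ → ℚ) → ℚ
sumTo zero f = 0ℚ
sumTo (suc N) f = sumTo N f + f (suc N)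

-- Truncated multiple zeta value:
-- zetaT (s₁ ∷ … ∷ s_r) N = Σ_{N ≥ m₁ > ⋯ > m_r ≥ 1} m₁^{-s₁} ⋯ m_r^{-s_r}
zetaT : List ℕ → ℕ → ℚ
zetaT [] N = 1ℚ
zetaT (s ∷ ss) N = sumTo N (λ { zero → 0ℚ ; (suc k) → powℚ (+ 1 / suc k) s * zetaT ss k })

sumℚ : List ℚ → ℚ
sumℚ [] = 0ℚ
sumℚ (x ∷ xs) = x + sumℚ xs

-- A permutation is built by choosing the entry at (0-based) position i to go
-- first (sign (-1)^i) and recursively permuting the remaining entries; this
-- enumerates every σ ∈ S_n exactly once, with sgn(σ) = (-1)^i · sgn(σ').
signedPermsAux : ℕ → List ℕ → List (ℚ × List ℕ)
signedPermsAux zero xs = (1ℚ , []) ∷ []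
signedPermsAux (suc n) xs = concat (map pick (Data.List.allFin (length xs)))
  where
  pick : Fin (length xs) → List (ℚ × List ℕ)
  pick i = map (λ p → (sgnPow (toℕ i) * proj₁ p , lookup xs i ∷ proj₂ p))
               (signedPermsAux n (removeAt xs i))

-- (the fuel argument is the length of the list, so it decreases exactly
-- as the list shrinks)
signedPerms : List ℕ → List (ℚ × List ℕ)
signedPerms xs = signedPermsAux (length xs) xs

altZetaT : List ℕ → ℕ → ℚ
altZetaT s N = sumℚ (map (λ p → proj₁ p * zetaT (proj₂ p) N) (signedPerms s))

Converges : List ℕ → Set
Converges s = ∀ (ε : ℚ) → 0ℚ < ε → ∃ λ N → ∀ M → N ℕ.≤ M → ∣ zetaT s M - zetaT s N ∣ < ε

TendsToZero : (ℕ → ℚ) → Set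
TendsToZero a = ∀ (ε : ℚ) → 0ℚ < ε → ∃ λ N → ∀ M → N ℕ.≤ M → ∣ a M ∣ < ε

-- Σ_j (-1)^{n-j} ζ_N(s_j) Σ_{σ ∈ S_n^j} sgn(σ) ζ_N(σ(s^j)), j 1-based,
-- here j = toℕ i + 1 for i : Fin n.
rhsT : List ℕ → ℕ → ℚ
rhsT s N = sumℚ (map (λ i → sgnPow (length s ℕ.∸ (toℕ i ℕ.+ 1))
                        * zetaT (lookup s i ∷ []) N
                        * altZetaT (removeAt s i) N)
                     (Data.List.allFin (length s)))

module Submission where

open import Defs
open import Data.Nat using (ℕ; _≤_; _*_; _+_)
open import Data.Rational using (_-_)
open import Data.List using (List; []; _∷_; length; lookup; removeAt)
open import Data.List.Relation.Unary.All using (All)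
open import Data.List.Relation.Unary.AllPairs using (AllPairs)
open import Data.Fin using (Fin)
open import Data.Product using (∃; proj₂)
open import Relation.Binary.PropositionalEquality using (_≡_; _≢_)

open import Algebra.Bundles using (Ring)
open import Data.Fin as Fin using (toℕ)
open import Data.Fin.Properties using (toℕ<n)
open import Data.Integer using (+_)
open import Data.List using (map; concat; _++_; allFin; tabulate)
import Data.List.Properties as List
open import Data.Nat as ℕ using (zero; suc; _∸_; z≤n; s≤s)
import Data.Nat.Properties as ℕ
open import Data.Product using (_×_; _,_; proj₁)
open import Data.Rational as ℚ using (ℚ; 0ℚ; 1ℚ; -_; ½)
  renaming (_+_ to _+ℚ_; _*_ to _*ℚ_)
import Data.Rational.Properties as ℚ
open import Data.Rational.Solver using (module +-*-Solver)
open +-*-Solver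
open import Algebra.Properties.Semiring.Sum (Ring.semiring ℚ.+-*-ring)
  using (sum; sum-syntax; sum-cong-≗; ∑-distrib-+; *-distribˡ-sum)
open import Function using (_∘_; id; flip)
open import Relation.Binary.PropositionalEquality
  using (refl; sym; trans; cong; cong₂; subst; module ≡-Reasoning)
open ≡-Reasoning

-- Write A_N(s) = altZetaT s N and E_N(s) = Σ_j (-1)^j ζ_N(s_j) A_N(s^j), with 0-based j.
-- Expanding every permutation along its first entry shows that raising the truncation
-- from N to N+1 adds T_N(s) = Σ_i (-1)^i (N+1)^(-s_i) A_N(s^i) to A_N(s). Doing the same
-- inside E_{N+1}(s) produces sums over two removed positions; these are antisymmetric
-- under exchanging the roles of the two positions, which yields
--   E_{N+1}(s) = E_N(s) + T_N(s) - Σ_j (-1)^j (N+1)^(-s_j) E_N(s^j).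
-- Induction on N then gives E_N(s) = A_N(s) for |s| odd and E_N(s) = 0 for |s| even.
-- For odd n the sign (-1)^(n-j) of the statement is (-1)^(j-1).

sumℚ-++ : ∀ xs ys → sumℚ (xs ++ ys) ≡ sumℚ xs +ℚ sumℚ ys
sumℚ-++ []       ys = sym (ℚ.+-identityˡ (sumℚ ys))
sumℚ-++ (x ∷ xs) ys = trans (cong (x +ℚ_) (sumℚ-++ xs ys)) (sym (ℚ.+-assoc x (sumℚ xs) (sumℚ ys)))

sumℚ-concat : ∀ xss → sumℚ (concat xss) ≡ sumℚ (map sumℚ xss)
sumℚ-concat []         = refl
sumℚ-concat (xs ∷ xss) = trans (sumℚ-++ xs (concat xss)) (cong (sumℚ xs +ℚ_) (sumℚ-concat xss))

sumℚ-tabulate : ∀ {n} (f : Fin n → ℚ) → sumℚ (tabulate f) ≡ sum f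
sumℚ-tabulate {zero}  f = refl
sumℚ-tabulate {suc n} f = cong (f Fin.zero +ℚ_) (sumℚ-tabulate (f ∘ Fin.suc))

sumℚ-allFin : ∀ n (f : Fin n → ℚ) → sumℚ (map f (allFin n)) ≡ sum f
sumℚ-allFin n f = trans (cong sumℚ (List.map-tabulate id f)) (sumℚ-tabulate f)

module _ {A : Set} where

  sumℚ-map-+ : ∀ (f g : A → ℚ) xs →
    sumℚ (map (λ x → f x +ℚ g x) xs) ≡ sumℚ (map f xs) +ℚ sumℚ (map g xs)
  sumℚ-map-+ f g []       = refl
  sumℚ-map-+ f g (x ∷ xs) = trans (cong (f x +ℚ g x +ℚ_) (sumℚ-map-+ f g xs))
    (solve 4 (λ a b c d → (a :+ b) :+ (c :+ d) := (a :+ c) :+ (b :+ d)) refl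
      (f x) (g x) (sumℚ (map f xs)) (sumℚ (map g xs)))

  sumℚ-map-* : ∀ c (f : A → ℚ) xs → sumℚ (map (λ x → c *ℚ f x) xs) ≡ c *ℚ sumℚ (map f xs)
  sumℚ-map-* c f []       = sym (ℚ.*-zeroʳ c)
  sumℚ-map-* c f (x ∷ xs) = trans (cong (c *ℚ f x +ℚ_) (sumℚ-map-* c f xs))
    (sym (ℚ.*-distribˡ-+ c (f x) (sumℚ (map f xs))))

∑-neg : ∀ {n} (f : Fin n → ℚ) → ∑[ i < n ] (- f i) ≡ - sum f
∑-neg {zero}  f = refl
∑-neg {suc n} f = trans (cong (- f Fin.zero +ℚ_) (∑-neg (f ∘ Fin.suc)))
  (sym (ℚ.neg-distrib-+ (f Fin.zero) (sum (f ∘ Fin.suc))))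

module _ {A : Set} where

  removalSum : (A → List A → ℚ) → List A → ℚ
  removalSum H L = ∑[ i < length L ] (sgnPow (toℕ i) *ℚ H (lookup L i) (removeAt L i))

  removalSum-cong : ∀ {H H′ : A → List A → ℚ} L →
    (∀ a R → H a R ≡ H′ a R) → removalSum H L ≡ removalSum H′ L
  removalSum-cong L eq = sum-cong-≗ (λ i → cong (sgnPow (toℕ i) *ℚ_) (eq (lookup L i) (removeAt L i)))

  removalSum-length : ∀ (H : A → List A → ℕ → ℚ) x L →
    removalSum (λ a R → H a R (length R)) (x ∷ L) ≡ removalSum (λ a R → H a R (length L)) (x ∷ L)
  removalSum-length H x L = sum-cong-≗ (λ i →
    cong (λ n → sgnPow (toℕ i) *ℚ H (lookup (x ∷ L) i) (removeAt (x ∷ L) i) n)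
         (List.length-removeAt (x ∷ L) i))

  removalSum-+ : ∀ H H′ L →
    removalSum (λ a R → H a R +ℚ H′ a R) L ≡ removalSum H L +ℚ removalSum H′ L
  removalSum-+ H H′ L = trans
    (sum-cong-≗ (λ i → ℚ.*-distribˡ-+ (ε i) (H (L! i) (L∖ i)) (H′ (L! i) (L∖ i))))
    (∑-distrib-+ (λ i → ε i *ℚ H (L! i) (L∖ i)) (λ i → ε i *ℚ H′ (L! i) (L∖ i)))
    where
    ε = sgnPow ∘ toℕ
    L! = lookup L
    L∖ = removeAt L

  removalSum-* : ∀ c H L → removalSum (λ a R → c *ℚ H a R) L ≡ c *ℚ removalSum H L
  removalSum-* c H L = trans
    (sum-cong-≗ (λ i → solve 3 (λ e c h → e :* (c :* h) := c :* (e :* h)) refl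
                         (sgnPow (toℕ i)) c (H (lookup L i) (removeAt L i))))
    (sym (*-distribˡ-sum c (λ i → sgnPow (toℕ i) *ℚ H (lookup L i) (removeAt L i))))

  removalSum-neg : ∀ H L → removalSum (λ a R → - H a R) L ≡ - removalSum H L
  removalSum-neg H L = trans
    (sum-cong-≗ (λ i → sym (ℚ.neg-distribʳ-* (sgnPow (toℕ i)) (H (lookup L i) (removeAt L i)))))
    (∑-neg (λ i → sgnPow (toℕ i) *ℚ H (lookup L i) (removeAt L i)))

  removalSum-- : ∀ H H′ L →
    removalSum (λ a R → H a R - H′ a R) L ≡ removalSum H L - removalSum H′ L
  removalSum-- H H′ L = trans (removalSum-+ H (λ a R → - H′ a R) L)
                              (cong (removalSum H L +ℚ_) (removalSum-neg H′ L))

  removalSum-∷ : ∀ H x L → removalSum H (x ∷ L) ≡ H x L - removalSum (λ a R → H a (x ∷ R)) L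
  removalSum-∷ H x L = cong₂ _+ℚ_ (ℚ.*-identityˡ (H x L)) (trans
    (sum-cong-≗ (λ i → sym (ℚ.neg-distribˡ-* (sgnPow (toℕ i)) (H (lookup L i) (x ∷ removeAt L i)))))
    (∑-neg (λ i → sgnPow (toℕ i) *ℚ H (lookup L i) (x ∷ removeAt L i))))

  doubleRemovalSum : (A → A → List A → ℚ) → List A → ℚ
  doubleRemovalSum G = removalSum (λ a → removalSum (G a))

  doubleRemovalSum-cong : ∀ {G G′ : A → A → List A → ℚ} L →
    (∀ a b R → G a b R ≡ G′ a b R) → doubleRemovalSum G L ≡ doubleRemovalSum G′ L
  doubleRemovalSum-cong L eq = removalSum-cong L (λ a R → removalSum-cong R (eq a))

  doubleRemovalSum-∷ : ∀ G x L → doubleRemovalSum G (x ∷ L)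
    ≡ (removalSum (G x) L - removalSum (flip G x) L) +ℚ doubleRemovalSum (λ a b R → G a b (x ∷ R)) L
  doubleRemovalSum-∷ G x L = begin
    doubleRemovalSum G (x ∷ L)
      ≡⟨ removalSum-∷ (λ a → removalSum (G a)) x L ⟩
    removalSum (G x) L - removalSum (λ a R → removalSum (G a) (x ∷ R)) L
      ≡⟨ cong (λ r → removalSum (G x) L - r) (removalSum-cong L (λ a R → removalSum-∷ (G a) x R)) ⟩
    removalSum (G x) L - removalSum (λ a R → G a x R - removalSum (λ b R′ → G a b (x ∷ R′)) R) L
      ≡⟨ cong (λ r → removalSum (G x) L - r)
              (removalSum-- (flip G x) (λ a → removalSum (λ b R′ → G a b (x ∷ R′))) L) ⟩
    removalSum (G x) L - (removalSum (flip G x) L - d)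
      ≡⟨ solve 3 (λ g g′ d → g :- (g′ :- d) := (g :- g′) :+ d) refl
           (removalSum (G x) L) (removalSum (flip G x) L) d ⟩
    (removalSum (G x) L - removalSum (flip G x) L) +ℚ d
      ∎
    where d = doubleRemovalSum (λ a b R → G a b (x ∷ R)) L

  doubleRemovalSum-flip : ∀ G L → doubleRemovalSum G L +ℚ doubleRemovalSum (flip G) L ≡ 0ℚ
  doubleRemovalSum-flip G []      = refl
  doubleRemovalSum-flip G (x ∷ L) = begin
    doubleRemovalSum G (x ∷ L) +ℚ doubleRemovalSum (flip G) (x ∷ L)
      ≡⟨ cong₂ _+ℚ_ (doubleRemovalSum-∷ G x L) (doubleRemovalSum-∷ (flip G) x L) ⟩
    ((g - g′) +ℚ d) +ℚ ((g′ - g) +ℚ d′)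
      ≡⟨ solve 4 (λ g g′ d d′ → ((g :- g′) :+ d) :+ ((g′ :- g) :+ d′) := d :+ d′) refl g g′ d d′ ⟩
    d +ℚ d′
      ≡⟨ doubleRemovalSum-flip (λ a b R → G a b (x ∷ R)) L ⟩
    0ℚ
      ∎
    where
    g = removalSum (G x) L
    g′ = removalSum (flip G x) L
    d = doubleRemovalSum (λ a b R → G a b (x ∷ R)) L
    d′ = doubleRemovalSum (λ a b R → G b a (x ∷ R)) L

  doubleRemovalSum-antisymmetric : ∀ G L → doubleRemovalSum G L ≡ - doubleRemovalSum (flip G) L
  doubleRemovalSum-antisymmetric G L = begin
    d                 ≡⟨ solve 2 (λ d d′ → d := (d :+ d′) :- d′) refl d d′ ⟩
    (d +ℚ d′) - d′    ≡⟨ cong (_- d′) (doubleRemovalSum-flip G L) ⟩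
    0ℚ - d′           ≡⟨ ℚ.+-identityˡ (- d′) ⟩
    - d′              ∎
    where
    d = doubleRemovalSum G L
    d′ = doubleRemovalSum (flip G) L

  doubleRemovalSum-symmetric : ∀ G L → (∀ a b R → G a b R ≡ G b a R) → doubleRemovalSum G L ≡ 0ℚ
  doubleRemovalSum-symmetric G L G-symmetric = begin
    d                  ≡⟨ solve 1 (λ d → d := con ½ :* (d :+ d)) refl d ⟩
    ½ *ℚ (d +ℚ d)      ≡⟨ cong (λ d′ → ½ *ℚ (d +ℚ d′)) (doubleRemovalSum-cong L G-symmetric) ⟩
    ½ *ℚ (d +ℚ d′)     ≡⟨ cong (½ *ℚ_) (doubleRemovalSum-flip G L) ⟩
    ½ *ℚ 0ℚ            ≡⟨ ℚ.*-zeroʳ ½ ⟩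
    0ℚ                 ∎
    where
    d = doubleRemovalSum G L
    d′ = doubleRemovalSum (flip G) L

altSum : (List ℕ → ℚ) → List ℕ → ℚ
altSum f s = sumℚ (map (λ p → proj₁ p *ℚ f (proj₂ p)) (signedPerms s))

altSum-+ : ∀ f g s → altSum (λ t → f t +ℚ g t) s ≡ altSum f s +ℚ altSum g s
altSum-+ f g s = trans
  (cong sumℚ (List.map-cong (λ p → ℚ.*-distribˡ-+ (proj₁ p) (f (proj₂ p)) (g (proj₂ p))) (signedPerms s)))
  (sumℚ-map-+ (λ p → proj₁ p *ℚ f (proj₂ p)) (λ p → proj₁ p *ℚ g (proj₂ p)) (signedPerms s))

altSum-* : ∀ c f s → altSum (λ t → c *ℚ f t) s ≡ c *ℚ altSum f s
altSum-* c f s = trans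
  (cong sumℚ (List.map-cong (λ p → solve 3 (λ e c y → e :* (c :* y) := c :* (e :* y)) refl
                                      (proj₁ p) c (f (proj₂ p)))
                            (signedPerms s)))
  (sumℚ-map-* c (λ p → proj₁ p *ℚ f (proj₂ p)) (signedPerms s))

altSum-expand : ∀ f x L → altSum f (x ∷ L) ≡ removalSum (λ a R → altSum (f ∘ (a ∷_)) R) (x ∷ L)
altSum-expand f x L = begin
  sumℚ (map weigh (concat (map pick (allFin (length s)))))
    ≡⟨ cong sumℚ (List.concat-map (map pick (allFin (length s)))) ⟨
  sumℚ (concat (map (map weigh) (map pick (allFin (length s)))))
    ≡⟨ sumℚ-concat (map (map weigh) (map pick (allFin (length s)))) ⟩
  sumℚ (map sumℚ (map (map weigh) (map pick (allFin (length s)))))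
    ≡⟨ cong sumℚ (List.map-∘ {g = sumℚ} {f = map weigh} (map pick (allFin (length s)))) ⟨
  sumℚ (map (sumℚ ∘ map weigh) (map pick (allFin (length s))))
    ≡⟨ cong sumℚ (List.map-∘ {g = sumℚ ∘ map weigh} {f = pick} (allFin (length s))) ⟨
  sumℚ (map (sumℚ ∘ map weigh ∘ pick) (allFin (length s)))
    ≡⟨ sumℚ-allFin (length s) (sumℚ ∘ map weigh ∘ pick) ⟩
  ∑[ i < length s ] sumℚ (map weigh (pick i))
    ≡⟨ sum-cong-≗ expand-row ⟩
  ∑[ i < length s ] (sgnPow (toℕ i) *ℚ altSum (f ∘ (lookup s i ∷_)) (removeAt s i))
    ∎
  where
  s = x ∷ L
  weigh : ℚ × List ℕ → ℚ
  weigh p = proj₁ p *ℚ f (proj₂ p)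
  perms : Fin (length s) → List (ℚ × List ℕ)
  perms i = signedPermsAux (length L) (removeAt s i)
  pick : Fin (length s) → List (ℚ × List ℕ)
  pick i = map (λ p → (sgnPow (toℕ i) *ℚ proj₁ p , lookup s i ∷ proj₂ p)) (perms i)
  altSumWithFuel : Fin (length s) → ℕ → ℚ
  altSumWithFuel i n = sumℚ (map (λ p → proj₁ p *ℚ f (lookup s i ∷ proj₂ p))
                                 (signedPermsAux n (removeAt s i)))
  expand-row : ∀ i → sumℚ (map weigh (pick i))
                   ≡ sgnPow (toℕ i) *ℚ altSum (f ∘ (lookup s i ∷_)) (removeAt s i)
  expand-row i = begin
    sumℚ (map weigh (pick i))
      ≡⟨ cong sumℚ (List.map-∘ {g = weigh} (perms i)) ⟨
    sumℚ (map (λ p → (ε *ℚ proj₁ p) *ℚ f (lookup s i ∷ proj₂ p)) (perms i))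
      ≡⟨ cong sumℚ (List.map-cong (λ p → ℚ.*-assoc ε (proj₁ p) (f (lookup s i ∷ proj₂ p))) (perms i)) ⟩
    sumℚ (map (λ p → ε *ℚ (proj₁ p *ℚ f (lookup s i ∷ proj₂ p))) (perms i))
      ≡⟨ sumℚ-map-* ε (λ p → proj₁ p *ℚ f (lookup s i ∷ proj₂ p)) (perms i) ⟩
    ε *ℚ altSumWithFuel i (length L)
      ≡⟨ cong (λ n → ε *ℚ altSumWithFuel i n) (List.length-removeAt s i) ⟨
    ε *ℚ altSum (f ∘ (lookup s i ∷_)) (removeAt s i)
      ∎
    where ε = sgnPow (toℕ i)

invPow : ℕ → ℕ → ℚ
invPow N x = powℚ (+ 1 ℚ./ suc N) x

increment : ℕ → List ℕ → ℚ
increment N = removalSum (λ a R → invPow N a *ℚ altZetaT R N)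

altZetaT-suc : ∀ N s → altZetaT s (suc N) ≡ altZetaT s N +ℚ increment N s
altZetaT-suc N []         = sym (ℚ.+-identityʳ 1ℚ)
altZetaT-suc N s@(x ∷ L) = begin
  altZetaT s (suc N)
    ≡⟨ altSum-expand (λ t → zetaT t (suc N)) x L ⟩
  removalSum (λ a R → altSum (λ t → zetaT (a ∷ t) N +ℚ invPow N a *ℚ zetaT t N) R) s
    ≡⟨ removalSum-cong s split ⟩
  removalSum (λ a R → altSum (λ t → zetaT (a ∷ t) N) R +ℚ invPow N a *ℚ altZetaT R N) s
    ≡⟨ removalSum-+ (λ a R → altSum (λ t → zetaT (a ∷ t) N) R) (λ a R → invPow N a *ℚ altZetaT R N) s ⟩
  removalSum (λ a R → altSum (λ t → zetaT (a ∷ t) N) R) s +ℚ increment N s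
    ≡⟨ cong (_+ℚ increment N s) (altSum-expand (λ t → zetaT t N) x L) ⟨
  altZetaT s N +ℚ increment N s
    ∎
  where
  split : ∀ a R → altSum (λ t → zetaT (a ∷ t) N +ℚ invPow N a *ℚ zetaT t N) R
                ≡ altSum (λ t → zetaT (a ∷ t) N) R +ℚ invPow N a *ℚ altZetaT R N
  split a R = trans (altSum-+ (λ t → zetaT (a ∷ t) N) (λ t → invPow N a *ℚ zetaT t N) R)
                    (cong (altSum (λ t → zetaT (a ∷ t) N) R +ℚ_)
                          (altSum-* (invPow N a) (λ t → zetaT t N) R))

altZetaT-zero : ∀ x L → altZetaT (x ∷ L) 0 ≡ 0ℚ
altZetaT-zero x L = begin
  altZetaT (x ∷ L) 0
    ≡⟨ altSum-expand (λ t → zetaT t 0) x L ⟩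
  removalSum (λ _ R → altSum (λ _ → 0ℚ) R) (x ∷ L)
    ≡⟨ removalSum-cong (x ∷ L) (λ _ R → altSum-* 0ℚ (λ _ → 0ℚ) R) ⟩
  removalSum (λ _ R → 0ℚ *ℚ altSum (λ _ → 0ℚ) R) (x ∷ L)
    ≡⟨ removalSum-* 0ℚ (λ _ R → altSum (λ _ → 0ℚ) R) (x ∷ L) ⟩
  0ℚ *ℚ removalSum (λ _ R → altSum (λ _ → 0ℚ) R) (x ∷ L)
    ≡⟨ ℚ.*-zeroˡ (removalSum (λ _ R → altSum (λ _ → 0ℚ) R) (x ∷ L)) ⟩
  0ℚ
    ∎

expansionT : ℕ → List ℕ → ℚ
expansionT N = removalSum (λ a R → zetaT (a ∷ []) N *ℚ altZetaT R N)

expansionT-zero : ∀ s → expansionT 0 s ≡ 0ℚ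
expansionT-zero s = trans (removalSum-* 0ℚ (λ _ R → altZetaT R 0) s)
                          (ℚ.*-zeroˡ (removalSum (λ _ R → altZetaT R 0) s))

removalSum-*-increment : ∀ (f : ℕ → ℚ) N s →
  removalSum (λ a R → f a *ℚ increment N R) s
    ≡ doubleRemovalSum (λ a b R → f a *ℚ (invPow N b *ℚ altZetaT R N)) s
removalSum-*-increment f N s =
  removalSum-cong s (λ a R → sym (removalSum-* (f a) (λ b R′ → invPow N b *ℚ altZetaT R′ N) R))

removalSum-zetaT*increment : ∀ N s →
  removalSum (λ a R → zetaT (a ∷ []) N *ℚ increment N R) s
    ≡ - removalSum (λ a R → invPow N a *ℚ expansionT N R) s
removalSum-zetaT*increment N s = begin
  removalSum (λ a R → ζ a *ℚ increment N R) s
    ≡⟨ removalSum-*-increment ζ N s ⟩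
  doubleRemovalSum (λ a b R → ζ a *ℚ (w b *ℚ A R)) s
    ≡⟨ doubleRemovalSum-antisymmetric (λ a b R → ζ a *ℚ (w b *ℚ A R)) s ⟩
  - doubleRemovalSum (λ a b R → ζ b *ℚ (w a *ℚ A R)) s
    ≡⟨ cong -_ (removalSum-cong s (λ a R → trans
         (removalSum-cong R (λ b R′ → solve 3 (λ z v x → z :* (v :* x) := v :* (z :* x)) refl
                                        (ζ b) (w a) (A R′)))
         (removalSum-* (w a) (λ b R′ → ζ b *ℚ A R′) R))) ⟩
  - removalSum (λ a R → w a *ℚ expansionT N R) s
    ∎
  where
  ζ w : ℕ → ℚ
  ζ a = zetaT (a ∷ []) N
  w = invPow N
  A : List ℕ → ℚ
  A R = altZetaT R N

removalSum-invPow*increment : ∀ N s → removalSum (λ a R → invPow N a *ℚ increment N R) s ≡ 0ℚ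
removalSum-invPow*increment N s = trans (removalSum-*-increment (invPow N) N s)
  (doubleRemovalSum-symmetric (λ a b R → invPow N a *ℚ (invPow N b *ℚ altZetaT R N)) s
    (λ a b R → solve 3 (λ u v x → u :* (v :* x) := v :* (u :* x)) refl
                 (invPow N a) (invPow N b) (altZetaT R N)))

expansionT-suc : ∀ N s → expansionT (suc N) s
  ≡ (expansionT N s +ℚ increment N s) - removalSum (λ a R → invPow N a *ℚ expansionT N R) s
expansionT-suc N s = begin
  expansionT (suc N) s
    ≡⟨ removalSum-cong s (λ a R → expand (ζ a) (w a) R) ⟩
  removalSum (λ a R → (ζ a *ℚ A R +ℚ w a *ℚ A R) +ℚ (ζ a *ℚ T R +ℚ w a *ℚ T R)) s
    ≡⟨ removalSum-+ (λ a R → ζ a *ℚ A R +ℚ w a *ℚ A R) (λ a R → ζ a *ℚ T R +ℚ w a *ℚ T R) s ⟩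
  removalSum (λ a R → ζ a *ℚ A R +ℚ w a *ℚ A R) s +ℚ removalSum (λ a R → ζ a *ℚ T R +ℚ w a *ℚ T R) s
    ≡⟨ cong₂ _+ℚ_ (removalSum-+ (λ a R → ζ a *ℚ A R) (λ a R → w a *ℚ A R) s)
                  (removalSum-+ (λ a R → ζ a *ℚ T R) (λ a R → w a *ℚ T R) s) ⟩
  (expansionT N s +ℚ increment N s)
    +ℚ (removalSum (λ a R → ζ a *ℚ T R) s +ℚ removalSum (λ a R → w a *ℚ T R) s)
    ≡⟨ cong₂ (λ u v → (expansionT N s +ℚ increment N s) +ℚ (u +ℚ v))
             (removalSum-zetaT*increment N s) (removalSum-invPow*increment N s) ⟩
  (expansionT N s +ℚ increment N s) +ℚ (- removalSum (λ a R → w a *ℚ expansionT N R) s +ℚ 0ℚ)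
    ≡⟨ cong ((expansionT N s +ℚ increment N s) +ℚ_) (ℚ.+-identityʳ _) ⟩
  (expansionT N s +ℚ increment N s) - removalSum (λ a R → w a *ℚ expansionT N R) s
    ∎
  where
  ζ w : ℕ → ℚ
  ζ a = zetaT (a ∷ []) N
  w = invPow N
  A T : List ℕ → ℚ
  A R = altZetaT R N
  T = increment N
  expand : ∀ z v R → (z +ℚ v *ℚ 1ℚ) *ℚ altZetaT R (suc N)
                   ≡ (z *ℚ A R +ℚ v *ℚ A R) +ℚ (z *ℚ T R +ℚ v *ℚ T R)
  expand z v R = trans (cong ((z +ℚ v *ℚ 1ℚ) *ℚ_) (altZetaT-suc N R))
    (solve 4 (λ z v a t → (z :+ v :* con 1ℚ) :* (a :+ t) := (z :* a :+ v :* a) :+ (z :* t :+ v :* t))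
      refl z v (A R) (T R))

oddness : ℕ → ℚ
oddness zero    = 0ℚ
oddness (suc n) = 1ℚ - oddness n

expansionT≡oddness*altZetaT : ∀ N s → expansionT N s ≡ oddness (length s) *ℚ altZetaT s N
expansionT≡oddness*altZetaT N       []        = sym (ℚ.*-zeroˡ (altZetaT [] N))
expansionT≡oddness*altZetaT zero    s@(x ∷ L) = begin
  expansionT 0 s                       ≡⟨ expansionT-zero s ⟩
  0ℚ                                   ≡⟨ ℚ.*-zeroʳ (oddness (length s)) ⟨
  oddness (length s) *ℚ 0ℚ             ≡⟨ cong (oddness (length s) *ℚ_) (altZetaT-zero x L) ⟨
  oddness (length s) *ℚ altZetaT s 0   ∎
expansionT≡oddness*altZetaT (suc N) s@(x ∷ L) = begin
  expansionT (suc N) s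
    ≡⟨ expansionT-suc N s ⟩
  (expansionT N s +ℚ increment N s) - removalSum (λ a R → invPow N a *ℚ expansionT N R) s
    ≡⟨ cong₂ (λ e r → (e +ℚ increment N s) - r) (expansionT≡oddness*altZetaT N s) removal-step ⟩
  ((1ℚ - c) *ℚ altZetaT s N +ℚ increment N s) - c *ℚ increment N s
    ≡⟨ solve 3 (λ c a t → (((con 1ℚ :- c) :* a) :+ t) :- c :* t := (con 1ℚ :- c) :* (a :+ t)) refl
         c (altZetaT s N) (increment N s) ⟩
  (1ℚ - c) *ℚ (altZetaT s N +ℚ increment N s)
    ≡⟨ cong ((1ℚ - c) *ℚ_) (altZetaT-suc N s) ⟨
  oddness (length s) *ℚ altZetaT s (suc N)
    ∎
  where
  c = oddness (length L)
  removal-step : removalSum (λ a R → invPow N a *ℚ expansionT N R) s ≡ c *ℚ increment N s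
  removal-step = begin
    removalSum (λ a R → invPow N a *ℚ expansionT N R) s
      ≡⟨ removalSum-cong s (λ a R → cong (invPow N a *ℚ_) (expansionT≡oddness*altZetaT N R)) ⟩
    removalSum (λ a R → invPow N a *ℚ (oddness (length R) *ℚ altZetaT R N)) s
      ≡⟨ removalSum-length (λ a R n → invPow N a *ℚ (oddness n *ℚ altZetaT R N)) x L ⟩
    removalSum (λ a R → invPow N a *ℚ (c *ℚ altZetaT R N)) s
      ≡⟨ removalSum-cong s (λ a R → solve 3 (λ w c x → w :* (c :* x) := c :* (w :* x)) refl
                                       (invPow N a) c (altZetaT R N)) ⟩
    removalSum (λ a R → c *ℚ (invPow N a *ℚ altZetaT R N)) s
      ≡⟨ removalSum-* c (λ a R → invPow N a *ℚ altZetaT R N) s ⟩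
    c *ℚ increment N s
      ∎

oddness-even : ∀ k → oddness (2 * k) ≡ 0ℚ
oddness-even zero    = refl
oddness-even (suc k) = trans (cong oddness (ℕ.*-suc 2 k))
  (trans (solve 1 (λ c → con 1ℚ :- (con 1ℚ :- c) := c) refl (oddness (2 * k))) (oddness-even k))

oddness-odd : ∀ k → oddness (2 * k + 1) ≡ 1ℚ
oddness-odd k = trans (cong oddness (ℕ.+-comm (2 * k) 1)) (cong (λ c → 1ℚ - c) (oddness-even k))

sgnPow-∸ : ∀ {i n} → i ≤ n → sgnPow (n ∸ i) ≡ sgnPow n *ℚ sgnPow i
sgnPow-∸ {n = n} z≤n = sym (ℚ.*-identityʳ (sgnPow n))
sgnPow-∸ (s≤s {i} {n} i≤n) = trans (sgnPow-∸ i≤n)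
  (solve 2 (λ a b → a :* b := (:- a) :* (:- b)) refl (sgnPow n) (sgnPow i))

sgnPow-even : ∀ k → sgnPow (2 * k) ≡ 1ℚ
sgnPow-even zero    = refl
sgnPow-even (suc k) = trans (cong sgnPow (ℕ.*-suc 2 k))
  (trans (solve 1 (λ a → :- :- a := a) refl (sgnPow (2 * k))) (sgnPow-even k))

sgnPow-odd∸suc : ∀ k {i} → i ≤ 2 * k → sgnPow (2 * k + 1 ∸ (i + 1)) ≡ sgnPow i
sgnPow-odd∸suc k {i} i≤2k = begin
  sgnPow (2 * k + 1 ∸ (i + 1))   ≡⟨ cong₂ (λ m n → sgnPow (m ∸ n)) (ℕ.+-comm (2 * k) 1) (ℕ.+-comm i 1) ⟩
  sgnPow (2 * k ∸ i)             ≡⟨ sgnPow-∸ i≤2k ⟩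
  sgnPow (2 * k) *ℚ sgnPow i     ≡⟨ cong (_*ℚ sgnPow i) (sgnPow-even k) ⟩
  1ℚ *ℚ sgnPow i                 ≡⟨ ℚ.*-identityˡ (sgnPow i) ⟩
  sgnPow i                       ∎

rhsT≡expansionT : ∀ s k → length s ≡ 2 * k + 1 → ∀ N → rhsT s N ≡ expansionT N s
rhsT≡expansionT s k |s|≡2k+1 N = trans (sumℚ-allFin (length s) _) (sum-cong-≗ (λ i →
  trans (cong (λ e → e *ℚ zetaT (lookup s i ∷ []) N *ℚ altZetaT (removeAt s i) N) (sign i))
        (ℚ.*-assoc (sgnPow (toℕ i)) (zetaT (lookup s i ∷ []) N) (altZetaT (removeAt s i) N))))
  where
  sign : (i : Fin (length s)) → sgnPow (length s ∸ (toℕ i + 1)) ≡ sgnPow (toℕ i)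
  sign i = trans (cong (λ n → sgnPow (n ∸ (toℕ i + 1))) |s|≡2k+1)
    (sgnPow-odd∸suc k (ℕ.m<1+n⇒m≤n (subst (toℕ i ℕ.<_) (trans |s|≡2k+1 (ℕ.+-comm (2 * k) 1)) (toℕ<n i))))

altZetaT≡rhsT : ∀ s k → length s ≡ 2 * k + 1 → ∀ N → altZetaT s N ≡ rhsT s N
altZetaT≡rhsT s k |s|≡2k+1 N = begin
  altZetaT s N                         ≡⟨ ℚ.*-identityˡ (altZetaT s N) ⟨
  1ℚ *ℚ altZetaT s N                   ≡⟨ cong (_*ℚ altZetaT s N) (oddness-odd k) ⟨
  oddness (2 * k + 1) *ℚ altZetaT s N  ≡⟨ cong (λ n → oddness n *ℚ altZetaT s N) |s|≡2k+1 ⟨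
  oddness (length s) *ℚ altZetaT s N   ≡⟨ expansionT≡oddness*altZetaT N s ⟨
  expansionT N s                       ≡⟨ rhsT≡expansionT s k |s|≡2k+1 N ⟨
  rhsT s N                             ∎

corollary4p4 : (s : List ℕ)
    → (∃ λ k → length s ≡ 2 * k + 1)
    → All (λ x → 1 ≤ x) s
    → AllPairs _≢_ s
    → All (λ p → Converges (proj₂ p)) (signedPerms s)
    → (∀ (j : Fin (length s)) → Converges (lookup s j ∷ []))
    → (∀ (j : Fin (length s)) → All (λ p → Converges (proj₂ p)) (signedPerms (removeAt s j)))
    → TendsToZero (λ N → altZetaT s N - rhsT s N)
corollary4p4 s (k , |s|≡2k+1) _ _ _ _ _ ε ε>0 = 0 , λ M _ →
  subst (λ d → ℚ.∣ d ∣ ℚ.< ε) (sym (difference-vanishes M)) ε>0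
  where
  difference-vanishes : ∀ M → altZetaT s M - rhsT s M ≡ 0ℚ
  difference-vanishes M = trans (cong (_- rhsT s M) (altZetaT≡rhsT s k |s|≡2k+1 M))
                                (ℚ.+-inverseʳ (rhsT s M))
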